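{- Let $n\ge 5$. The maximum possible value of $\mathrm{peri}(v)+\deg(v)$, over all trees $T$ of order $n$ and all vertices $v$ of $T$, is $n$.
   Context: For a graph $G$ and distinct vertices $u,v$, let $n_G(u,v)$ be the number of vertices strictly closer to $u$ than to $v$. The peripherality $\mathrm{peri}(v)$ of a vertex $v$ is the number of vertices $u\in V(G)$ with $n_G(u,v)>n_G(v,u)$; $\deg(v)$ is the degree of $v$. -}

module Defs where

open import Data.Nat using (ℕ; zero; suc; _+_; _<_; _<ᵇ_)
open import Data.Bool using (Bool; true; false; _∧_; _∨_; not; if_then_else_)
open import Data.Fin using (Fin; zero; suc; _≟_)
open import Data.Fin.Properties using ()
open import Data.List using (List; map; allFin)
open import Data.Nat.ListAction using (sum)
open import Data.Bool.ListAction using (any)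
open import Data.Product using (Σ; _×_)
open import Function.Definitions using (Injective)
open import Relation.Binary.PropositionalEquality using (_≡_)
open import Relation.Nullary.Decidable using (⌊_⌋)
open import Relation.Nullary using (¬_)

record Graph (n : ℕ) : Set where
  field
    adj     : Fin n → Fin n → Bool
    symm    : ∀ u v → adj u v ≡ adj v u
    irrefl  : ∀ v → adj v v ≡ false
open Graph public

count : ∀ {n} → (Fin n → Bool) → ℕ
count {n} p = sum (map (λ i → if p i then 1 else 0) (allFin n))

-- cyclic successor on Fin (suc m): i ↦ i+1 mod (m+1)
next : ∀ {m} → Fin (suc m) → Fin (suc m)
next {zero}  zero    = zero
next {suc m} zero    = suc zero
next {suc m} (suc i) = bump (next {m} i)
  where
  bump : Fin (suc m) → Fin (suc (suc m))
  bump zero    = zero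
  bump (suc j) = suc (suc j)

module _ {n : ℕ} (G : Graph n) where

  within : ℕ → Fin n → Fin n → Bool
  within zero    u v = ⌊ u ≟ v ⌋
  within (suc k) u v = within k u v ∨ any (λ w → adj G u w ∧ within k w v) (allFin n)

  Connected : Set
  Connected = ∀ u v → within n u v ≡ true

  Acyclic : Set
  Acyclic = ∀ k (c : Fin (suc (suc (suc k))) → Fin n) →
              Injective _≡_ _≡_ c → ¬ (∀ i → adj G (c i) (c (next i)) ≡ true)

  IsTree : Set
  IsTree = Connected × Acyclic

  -- distance d(u,v): the least k with a walk of length k from u to v
  -- (computed as the number of k < n with no walk of length ≤ k;
  --  this is the graph distance whenever u and v are connected)
  dist : Fin n → Fin n → ℕ
  dist u v = count {n} (λ (k : Fin n) → not (within (Data.Fin.toℕ k) u v))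

  nG : Fin n → Fin n → ℕ
  nG u v = count (λ w → dist w u <ᵇ dist w v)

  peri : Fin n → ℕ
  peri v = count (λ u → nG v u <ᵇ nG u v)

  deg : Fin n → ℕ
  deg v = count (λ w → adj G v w)

-- Let S be the set of vertices u with n(u,v) > n(v,u) and N the neighbourhood of v;
-- neither contains v. In a tree, a vertex closer to a neighbour w₂ of v than to v lies
-- beyond w₂, hence is closer to v than to any other neighbour w₁; so n(w₂,v) ≤ n(v,w₁).
-- Two neighbours w₁ ≠ w₂ in S would give n(w₂,v) ≤ n(v,w₁) < n(w₁,v) ≤ n(v,w₂) < n(w₂,v),
-- so |S ∩ N| ≤ 1 and peri(v) + deg(v) = |S ∪ N| + |S ∩ N| ≤ (n − 1) + 1.
-- The bound is attained at the end of a broom, a path root – mid – hub with n − 3 leaves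
-- at hub: every u ≠ root has n(root,u) ≤ 2 < n − 2 ≤ n(u,root), and deg(root) = 1.

module Submission where

open import Defs
open import Data.Bool using (Bool; true; false; _∧_; _∨_; not; if_then_else_; T)
open import Data.Bool.Properties using (T-≡; T-∨; T-∧; ¬-not; ∨-comm)
open import Data.Empty using (⊥; ⊥-elim)
open import Data.Fin using (Fin; zero; suc; toℕ; inject₁; fromℕ; _≟_)
open import Data.Fin.Properties using (toℕ-inject₁; toℕ-injective)
  renaming (0≢1+n to 0≢1+i; suc-injective to Fin-suc-injective)
open import Data.List using (List; []; _∷_; [_]; _++_; length; lookup; allFin)
open import Data.List.Extrema.Nat using (argmax; f[xs]≤f[argmax])
open import Data.List.Membership.Propositional using (lose)
open import Data.List.Membership.Propositional.Properties using (∈-lookup; ∈-allFin)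
open import Data.List.Properties using (map-tabulate)
open import Data.List.Relation.Unary.All as All using (All; []; _∷_)
open import Data.List.Relation.Unary.All.Properties using (∷ʳ⁺)
open import Data.List.Relation.Unary.AllPairs using ([]; _∷_)
import Data.List.Relation.Unary.AllPairs.Properties as AllPairs
open import Data.List.Relation.Unary.Any using (satisfied)
open import Data.List.Relation.Unary.Any.Properties using (any⁺; any⁻)
open import Data.List.Relation.Unary.Unique.Propositional using (Unique)
open import Data.Nat
  using (ℕ; zero; suc; pred; _+_; _∸_; _⊓_; _≤_; _<_; _<ᵇ_; _≡ᵇ_; z≤n; s≤s; _≤′_; ≤′-refl; ≤′-step)
open import Data.Nat.ListAction using (sum)
open import Data.Nat.Properties
  using ( +-comm; +-identityʳ; +-mono-≤; +-monoʳ-≤; +-commutativeSemigroup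
        ; 1+n≢n; n≤1+n; n≮0; m<m+n; m≤m+n; m≤n+m; m≤n⇒m≤1+n; m≤n+o⇒m∸n≤o; m≤n⇒∃[o]m+o≡n
        ; m≥n⇒m⊓n≡n; m⊓n≤n; m⊓n≤m; ⊓-sel; suc-injective; _≤?_; _<?_
        ; <-asym; <-cmp; <-irrefl; <-≤-trans; <ᵇ⇒<; <⇒<ᵇ; <⇒≤; <⇒≱; ≡ᵇ⇒≡
        ; ≤-antisym; ≤-pred; ≤-refl; ≤-reflexive; ≤-trans; ≤⇒≤′; ≤∧≢⇒<; ≮⇒≥; ≰⇒>
        ; module ≤-Reasoning )
open import Algebra.Properties.CommutativeSemigroup +-commutativeSemigroup using (interchange)
open import Data.Product using (Σ; ∃-syntax; _×_; _,_; proj₁; proj₂)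
open import Data.Sum using (_⊎_; inj₁; inj₂)
open import Function using (_∘_; id; _$_)
open import Function.Bundles using (Equivalence)
open import Relation.Binary.Definitions using (tri<; tri≈; tri>)
open import Relation.Binary.PropositionalEquality hiding ([_])
open import Relation.Nullary using (yes; no)
open import Relation.Nullary.Decidable using (toWitness; fromWitness)

open Equivalence using (to; from)

≡true⇒T : ∀ {b} → b ≡ true → T b
≡true⇒T = from T-≡

T⇒≡true : ∀ {b} → T b → b ≡ true
T⇒≡true = to T-≡

<ᵇ≡true⇒< : ∀ {m n} → (m <ᵇ n) ≡ true → m < n
<ᵇ≡true⇒< {m} {n} = <ᵇ⇒< m n ∘ ≡true⇒T

<⇒<ᵇ≡true : ∀ {m n} → m < n → (m <ᵇ n) ≡ true
<⇒<ᵇ≡true = T⇒≡true ∘ <⇒<ᵇ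

n<ᵇn≡false : ∀ n → (n <ᵇ n) ≡ false
n<ᵇn≡false n = ¬-not (<-irrefl refl ∘ <ᵇ≡true⇒< {n})

indicator : Bool → ℕ
indicator b = if b then 1 else 0

count-suc : ∀ {n} (p : Fin (suc n) → Bool) → count p ≡ indicator (p zero) + count (p ∘ suc)
count-suc p = cong (indicator (p zero) +_) $ cong sum $
  trans (map-tabulate suc (indicator ∘ p)) (sym (map-tabulate id (indicator ∘ p ∘ suc)))

count-none : ∀ {n} {p : Fin n → Bool} → (∀ i → p i ≡ false) → count p ≡ 0
count-none {zero} _ = refl
count-none {suc n} {p} none rewrite count-suc p | none zero = count-none (none ∘ suc)

count-pos : ∀ {n} {p : Fin n → Bool} (v : Fin n) → p v ≡ true → 0 < count p
count-pos {suc n} {p} zero pv rewrite count-suc p | pv = s≤s z≤n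
count-pos {suc n} {p} (suc v) pv rewrite count-suc p =
  ≤-trans (count-pos v pv) (m≤n+m _ (indicator (p zero)))

count-mono : ∀ {n} {p q : Fin n → Bool} → (∀ i → p i ≡ true → q i ≡ true) → count p ≤ count q
count-mono {zero} _ = z≤n
count-mono {suc n} {p} {q} p⇒q rewrite count-suc p | count-suc q =
  +-mono-≤ (indicator-mono (p⇒q zero)) (count-mono (p⇒q ∘ suc))
  where
  indicator-mono : ∀ {a b} → (a ≡ true → b ≡ true) → indicator a ≤ indicator b
  indicator-mono {false} _ = z≤n
  indicator-mono {true} a⇒b rewrite a⇒b refl = ≤-refl

count-compl : ∀ {n} (p : Fin n → Bool) → count p + count (not ∘ p) ≡ n
count-compl {zero} p = refl
count-compl {suc n} p rewrite count-suc p | count-suc (not ∘ p) =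
  trans (interchange (indicator (p zero)) _ _ _)
        (cong₂ _+_ (indicator-compl (p zero)) (count-compl (p ∘ suc)))
  where
  indicator-compl : ∀ b → indicator b + indicator (not b) ≡ 1
  indicator-compl false = refl
  indicator-compl true = refl

count-∨+∧ : ∀ {n} (p q : Fin n → Bool) →
            count p + count q ≡ count (λ i → p i ∨ q i) + count (λ i → p i ∧ q i)
count-∨+∧ {zero} p q = refl
count-∨+∧ {suc n} p q
  rewrite count-suc p | count-suc q | count-suc (λ i → p i ∨ q i) | count-suc (λ i → p i ∧ q i) =
  trans (interchange (indicator (p zero)) _ _ _)
  (trans (cong₂ _+_ (indicator-∨+∧ (p zero) (q zero)) (count-∨+∧ (p ∘ suc) (q ∘ suc)))
         (interchange (indicator (p zero ∨ q zero)) _ _ _))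
  where
  indicator-∨+∧ : ∀ a b → indicator a + indicator b ≡ indicator (a ∨ b) + indicator (a ∧ b)
  indicator-∨+∧ false false = refl
  indicator-∨+∧ false true = refl
  indicator-∨+∧ true false = refl
  indicator-∨+∧ true true = refl

count<n : ∀ {n} {p : Fin n → Bool} (v : Fin n) → p v ≡ false → count p < n
count<n {p = p} v pv =
  subst (count p <_) (count-compl p) (m<m+n (count p) (count-pos {p = not ∘ p} v (cong not pv)))

count≤1 : ∀ {n} {p : Fin n → Bool} → (∀ i j → p i ≡ true → p j ≡ true → i ≡ j) → count p ≤ 1
count≤1 {zero} _ = z≤n
count≤1 {suc n} {p} unique rewrite count-suc p with p zero in p0
... | true = ≤-reflexive (cong suc (count-none λ i → ¬-not (0≢1+i ∘ unique zero (suc i) p0)))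
... | false = count≤1 λ i j pi pj → Fin-suc-injective (unique (suc i) (suc j) pi pj)

count-toℕ< : ∀ n k → count {n} (λ i → toℕ i <ᵇ k) ≡ n ⊓ k
count-toℕ< zero k = refl
count-toℕ< (suc n) zero = count-none {suc n} (λ _ → refl)
count-toℕ< (suc n) (suc k) rewrite count-suc {n} (λ i → toℕ i <ᵇ suc k) = cong suc (count-toℕ< n k)

count≤-false-from : ∀ {n} {p : Fin n → Bool} k → (∀ i → k ≤ toℕ i → p i ≡ false) → count p ≤ k
count≤-false-from {n} {p} k vanish = begin
  count p                      ≤⟨ count-mono below ⟩
  count {n} (λ i → toℕ i <ᵇ k) ≡⟨ count-toℕ< n k ⟩
  n ⊓ k                        ≤⟨ m⊓n≤n n k ⟩
  k                            ∎
  where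
  open ≤-Reasoning
  below : ∀ i → p i ≡ true → (toℕ i <ᵇ k) ≡ true
  below i pᵢ with toℕ i <? k
  ... | yes i<k = <⇒<ᵇ≡true i<k
  ... | no i≮k with () ← trans (sym pᵢ) (vanish i (≮⇒≥ i≮k))

count≥-true-below : ∀ {n} {p : Fin n → Bool} k → k ≤ n → (∀ i → toℕ i < k → p i ≡ true) → k ≤ count p
count≥-true-below {n} {p} k k≤n below = begin
  k                            ≡⟨ sym (m≥n⇒m⊓n≡n k≤n) ⟩
  n ⊓ k                        ≡⟨ sym (count-toℕ< n k) ⟩
  count {n} (λ i → toℕ i <ᵇ k) ≤⟨ count-mono (λ i → below i ∘ <ᵇ≡true⇒<) ⟩
  count p                      ∎
  where open ≤-Reasoning

count≥-true-from : ∀ {n} {p : Fin n → Bool} k → (∀ i → k ≤ toℕ i → p i ≡ true) → n ∸ k ≤ count p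
count≥-true-from {n} {p} k above = m≤n+o⇒m∸n≤o n k $ begin
  n                            ≡⟨ sym (count-compl p) ⟩
  count p + count (not ∘ p)    ≤⟨ +-monoʳ-≤ (count p) (count≤-false-from k (λ i → cong not ∘ above i)) ⟩
  count p + k                  ≡⟨ +-comm (count p) k ⟩
  k + count p                  ∎
  where open ≤-Reasoning

next-inject₁ : ∀ {m} (i : Fin m) → next (inject₁ i) ≡ suc i
next-inject₁ {suc m} zero = refl
next-inject₁ {suc m} (suc i) rewrite next-inject₁ i = refl

next-fromℕ : ∀ m → next (fromℕ m) ≡ zero
next-fromℕ zero = refl
next-fromℕ (suc m) rewrite next-fromℕ m = refl

inject₁-or-fromℕ : ∀ {m} (i : Fin (suc m)) → (∃[ j ] i ≡ inject₁ j) ⊎ i ≡ fromℕ m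
inject₁-or-fromℕ {zero} zero = inj₂ refl
inject₁-or-fromℕ {suc m} zero = inj₁ (zero , refl)
inject₁-or-fromℕ {suc m} (suc i) with inject₁-or-fromℕ i
... | inj₁ (j , refl) = inj₁ (suc j , refl)
... | inj₂ refl = inj₂ refl

prev : ∀ {m} → Fin (suc m) → Fin (suc m)
prev {m} zero = fromℕ m
prev {suc m} (suc i) = inject₁ i

next-prev : ∀ {m} (i : Fin (suc m)) → next (prev i) ≡ i
next-prev {m} zero = next-fromℕ m
next-prev {suc m} (suc i) = next-inject₁ i

prev≢next : ∀ {k} (i : Fin (3 + k)) → prev i ≢ next i
prev≢next {k} i with inject₁-or-fromℕ i
... | inj₁ (zero , refl) = λ ()
... | inj₁ (suc j , refl) rewrite next-inject₁ (suc j) =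
  n≢2+n ∘ trans (sym (trans (toℕ-inject₁ (inject₁ j)) (toℕ-inject₁ j))) ∘ cong toℕ
  where
  n≢2+n : ∀ {a} → a ≢ suc (suc a)
  n≢2+n ()
... | inj₂ refl rewrite next-fromℕ (2 + k) = λ ()

lookup-injective : ∀ {A : Set} {xs : List A} → Unique xs → ∀ {i j} → lookup xs i ≡ lookup xs j → i ≡ j
lookup-injective (_ ∷ _) {zero} {zero} _ = refl
lookup-injective (x∉ ∷ _) {zero} {suc j} x≡ = ⊥-elim (All.lookup x∉ (∈-lookup j) x≡)
lookup-injective (x∉ ∷ _) {suc i} {zero} ≡x = ⊥-elim (All.lookup x∉ (∈-lookup i) (sym ≡x))
lookup-injective (_ ∷ xs!) {suc i} {suc j} eq = cong suc (lookup-injective xs! eq)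

unique-∷ʳ : ∀ {A : Set} {xs : List A} {y} → Unique xs → All (_≢ y) xs → Unique (xs ++ [ y ])
unique-∷ʳ xs! y∉ = AllPairs.++⁺ xs! ([] ∷ []) (All.map (_∷ []) y∉)

module Walks {n : ℕ} (G : Graph n) where

  adj-sym : ∀ {u v} → adj G u v ≡ true → adj G v u ≡ true
  adj-sym {u} {v} = trans (symm G v u)

  adj⇒≢ : ∀ {u v} → adj G u v ≡ true → u ≢ v
  adj⇒≢ {u} u~u refl with () ← trans (sym u~u) (irrefl G u)

  -- wrapping the Boolean test in a record lets Agda infer k, u and v
  record Within (k : ℕ) (u v : Fin n) : Set where
    constructor ⟨_⟩
    field holds : within G k u v ≡ true
  open Within

  within-zero⇒≡ : ∀ {u v} → Within 0 u v → u ≡ v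
  within-zero⇒≡ ⟨ h ⟩ = toWitness (≡true⇒T h)

  within-zero-refl : ∀ {v} → Within 0 v v
  within-zero-refl {v} = ⟨ T⇒≡true (fromWitness {a? = v ≟ v} refl) ⟩

  within-suc : ∀ {k u v} → Within k u v → Within (suc k) u v
  within-suc ⟨ h ⟩ = ⟨ T⇒≡true (from T-∨ (inj₁ (≡true⇒T h))) ⟩

  within-≤ : ∀ {k k′ u v} → k ≤ k′ → Within k u v → Within k′ u v
  within-≤ k≤k′ h = go (≤⇒≤′ k≤k′)
    where
    go : ∀ {k′} → _ ≤′ k′ → Within k′ _ _
    go ≤′-refl = h
    go (≤′-step k≤′k′) = within-suc (go k≤′k′)

  within-∷ : ∀ {k u w v} → adj G u w ≡ true → Within k w v → Within (suc k) u v
  within-∷ {w = w} u~w ⟨ h ⟩ = ⟨ T⇒≡true $ from T-∨ $ inj₂ $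
    any⁺ _ (lose (∈-allFin w) (from T-∧ (≡true⇒T u~w , ≡true⇒T h))) ⟩

  within-suc-inv : ∀ {k u v} → Within (suc k) u v →
                   Within k u v ⊎ ∃[ w ] adj G u w ≡ true × Within k w v
  within-suc-inv ⟨ h ⟩ with to T-∨ (≡true⇒T h)
  ... | inj₁ near = inj₁ ⟨ T⇒≡true near ⟩
  ... | inj₂ via with satisfied (any⁻ _ (allFin n) via)
  ...   | w , u~w∧h with to T-∧ u~w∧h
  ...     | u~w , h′ = inj₂ (w , T⇒≡true u~w , ⟨ T⇒≡true h′ ⟩)

  within-∷ʳ : ∀ {k u w v} → Within k u w → adj G w v ≡ true → Within (suc k) u v
  within-∷ʳ {zero} h w~v with refl ← within-zero⇒≡ h = within-∷ w~v within-zero-refl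
  within-∷ʳ {suc k} h w~v with within-suc-inv h
  ... | inj₁ h′ = within-suc (within-∷ʳ h′ w~v)
  ... | inj₂ (w′ , u~w′ , h′) = within-∷ u~w′ (within-∷ʳ h′ w~v)

  within-sym : ∀ {k u v} → Within k u v → Within k v u
  within-sym {zero} h with refl ← within-zero⇒≡ h = h
  within-sym {suc k} h with within-suc-inv h
  ... | inj₁ h′ = within-suc (within-sym h′)
  ... | inj₂ (w , u~w , h′) = within-∷ʳ (within-sym h′) (adj-sym u~w)

  within-++ : ∀ {k l u w v} → Within k u w → Within l w v → Within (k + l) u v
  within-++ {zero} h₁ h₂ with refl ← within-zero⇒≡ h₁ = h₂
  within-++ {suc k} h₁ h₂ with within-suc-inv h₁
  ... | inj₁ h₁′ = within-suc (within-++ h₁′ h₂)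
  ... | inj₂ (w , u~w , h₁′) = within-∷ u~w (within-++ h₁′ h₂)

  within-lipschitz : (f : Fin n → ℕ) → (∀ {a b} → adj G a b ≡ true → f a ≤ suc (f b)) →
                     ∀ {k u v} → Within k u v → f u ≤ k + f v
  within-lipschitz f f-step {zero} h with refl ← within-zero⇒≡ h = ≤-refl
  within-lipschitz f f-step {suc k} h with within-suc-inv h
  ... | inj₁ h′ = m≤n⇒m≤1+n (within-lipschitz f f-step h′)
  ... | inj₂ (w , u~w , h′) = ≤-trans (f-step u~w) (s≤s (within-lipschitz f f-step h′))

  dist≤ : ∀ {k u v} → Within k u v → dist G u v ≤ k
  dist≤ {k} h = count≤-false-from {n} k λ i k≤i → cong not (holds (within-≤ k≤i h))

  module Distance (connected : Connected G) where

    -- For k = dist u v < n: were the test false at k, it would be false at every k′ ≤ k,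
    -- and dist, which counts the k′ < n where it is false, would exceed k.
    within-dist : ∀ u v → Within (dist G u v) u v
    within-dist u v with n ≤? dist G u v
    ... | yes n≤d = within-≤ n≤d ⟨ connected u v ⟩
    ... | no n≰d with within G (dist G u v) u v in h
    ...   | true = ⟨ h ⟩
    ...   | false = ⊥-elim (<-irrefl refl (count≥-true-below {n} (suc (dist G u v)) (≰⇒> n≰d) missing))
      where
      missing : ∀ i → toℕ i < suc (dist G u v) → not (within G (toℕ i) u v) ≡ true
      missing i i≤d with within G (toℕ i) u v in hᵢ
      ... | false = refl
      ... | true with () ← trans (sym h) (holds (within-≤ (≤-pred i≤d) ⟨ hᵢ ⟩))

    dist≡0⇒≡ : ∀ {u v} → dist G u v ≡ 0 → u ≡ v
    dist≡0⇒≡ {u} {v} d≡0 = within-zero⇒≡ (subst (λ k → Within k u v) d≡0 (within-dist u v))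

    dist-edge : ∀ {u w} v → adj G u w ≡ true → dist G u v ≤ suc (dist G w v)
    dist-edge v u~w = dist≤ (within-∷ u~w (within-dist _ v))

    dist-suc⇒neighbour : ∀ {u v k} → dist G u v ≡ suc k → ∃[ w ] adj G u w ≡ true × dist G w v ≡ k
    dist-suc⇒neighbour {u} {v} {k} d≡1+k
      with within-suc-inv (subst (λ j → Within j u v) d≡1+k (within-dist u v))
    ... | inj₁ h = ⊥-elim (<-irrefl refl (subst (_≤ k) d≡1+k (dist≤ h)))
    ... | inj₂ (w , u~w , h) =
      w , u~w , ≤-antisym (dist≤ h) (≤-pred (subst (_≤ suc (dist G w v)) d≡1+k (dist-edge v u~w)))

    dist-sym : ∀ u v → dist G u v ≡ dist G v u
    dist-sym u v = ≤-antisym (dist≤ (within-sym (within-dist v u))) (dist≤ (within-sym (within-dist u v)))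

  data Path : Fin n → Fin n → List (Fin n) → Set where
    []ᵖ : ∀ {a} → Path a a []
    _∷ᵖ_ : ∀ {a c b L} → adj G a c ≡ true → Path c b L → Path a b (c ∷ L)
  infixr 5 _∷ᵖ_

  path-∷ʳ : ∀ {a b c L} → Path a b L → adj G b c ≡ true → Path a c (L ++ [ c ])
  path-∷ʳ []ᵖ b~c = b~c ∷ᵖ []ᵖ
  path-∷ʳ (a~a′ ∷ᵖ p) b~c = a~a′ ∷ᵖ path-∷ʳ p b~c

  path-step : ∀ {a b L} → Path a b L → (j : Fin (length L)) →
              adj G (lookup (a ∷ L) (inject₁ j)) (lookup (a ∷ L) (suc j)) ≡ true
  path-step (a~c ∷ᵖ _) zero = a~c
  path-step (_ ∷ᵖ p) (suc j) = path-step p j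

  path-last : ∀ {a b L} → Path a b L → lookup (a ∷ L) (fromℕ (length L)) ≡ b
  path-last []ᵖ = refl
  path-last (_ ∷ᵖ p) = path-last p

  acyclic⇒¬closing-edge : Acyclic G → ∀ {s e y z rest} → Path s e (y ∷ z ∷ rest) →
                          Unique (s ∷ y ∷ z ∷ rest) → adj G e s ≡ true → ⊥
  acyclic⇒¬closing-edge acyclic {s} {e} {y} {z} {rest} p cycle! e~s =
    acyclic (length rest) (lookup cycle) (lookup-injective cycle!) closed
    where
    cycle : List (Fin n)
    cycle = s ∷ y ∷ z ∷ rest
    closed : ∀ i → adj G (lookup cycle i) (lookup cycle (next i)) ≡ true
    closed i with inject₁-or-fromℕ i
    ... | inj₁ (j , refl) rewrite next-inject₁ j = path-step p j
    ... | inj₂ refl rewrite next-fromℕ (length (y ∷ z ∷ rest)) | path-last p = e~s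

module Tree {n : ℕ} (G : Graph n) (tree : IsTree G) where
  open Walks G
  open Distance (proj₁ tree)

  module _ (x : Fin n) where

    below⇒∉ : ∀ {ℓ p zs} → dist G p x < ℓ → All (λ z → ℓ ≤ dist G z x) zs → All (p ≢_) zs
    below⇒∉ p<ℓ = All.map λ ℓ≤z p≡z → <⇒≱ p<ℓ (subst (λ z → _ ≤ dist G z x) (sym p≡z) ℓ≤z)

    -- A valley: a simple path at levels ≥ ℓ, with both ends at level ℓ (level = distance to x).
    -- Stepping down from both ends, the two new vertices either coincide, closing a cycle,
    -- or extend the valley to one a level lower.
    valley-ends-≡ : ∀ ℓ {a b L} → Path a b L → Unique (a ∷ L) → All (λ z → ℓ ≤ dist G z x) (a ∷ L) →
                    dist G a x ≡ ℓ → dist G b x ≡ ℓ → a ≡ b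
    valley-ends-≡ zero _ _ _ a≡0 b≡0 = trans (dist≡0⇒≡ a≡0) (sym (dist≡0⇒≡ b≡0))
    valley-ends-≡ (suc ℓ) []ᵖ _ _ _ _ = refl
    valley-ends-≡ (suc ℓ) {a} {b} {c ∷ L} path@(_ ∷ᵖ _) path! above a≡1+ℓ b≡1+ℓ
      with dist-suc⇒neighbour a≡1+ℓ | dist-suc⇒neighbour b≡1+ℓ
    ... | p , a~p , p≡ℓ | q , b~q , q≡ℓ with p ≟ q
    ...   | yes refl = ⊥-elim (acyclic⇒¬closing-edge (proj₂ tree) (adj-sym a~p ∷ᵖ path) (p∉ ∷ path!) b~q)
      where
      p∉ : All (p ≢_) (a ∷ c ∷ L)
      p∉ = below⇒∉ (≤-reflexive (cong suc p≡ℓ)) above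
    ...   | no p≢q = ⊥-elim (p≢q (valley-ends-≡ ℓ lower lower! lower-above p≡ℓ q≡ℓ))
      where
      lower : Path p q (a ∷ c ∷ L ++ [ q ])
      lower = adj-sym a~p ∷ᵖ path-∷ʳ path b~q
      lower! : Unique (p ∷ a ∷ c ∷ L ++ [ q ])
      lower! = ∷ʳ⁺ (below⇒∉ (≤-reflexive (cong suc p≡ℓ)) above) p≢q
               ∷ unique-∷ʳ path! (All.map ≢-sym (below⇒∉ (≤-reflexive (cong suc q≡ℓ)) above))
      lower-above : All (λ z → ℓ ≤ dist G z x) (p ∷ a ∷ c ∷ L ++ [ q ])
      lower-above = ≤-reflexive (sym p≡ℓ) ∷ ∷ʳ⁺ (All.map <⇒≤ above) (≤-reflexive (sym q≡ℓ))

    adjacent-dist-≢ : ∀ {a b} → adj G a b ≡ true → dist G a x ≢ dist G b x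
    adjacent-dist-≢ a~b a≡b = adj⇒≢ a~b $
      valley-ends-≡ _ (a~b ∷ᵖ []ᵖ) ((adj⇒≢ a~b ∷ []) ∷ [] ∷ [])
                      (≤-refl ∷ ≤-reflexive a≡b ∷ []) refl (sym a≡b)

    lower-neighbour-unique : ∀ {v p q} → adj G v p ≡ true → adj G v q ≡ true →
                             dist G p x < dist G v x → dist G q x < dist G v x → p ≡ q
    lower-neighbour-unique {v} {p} {q} v~p v~q p<v q<v with p ≟ q
    ... | yes p≡q = p≡q
    ... | no p≢q = valley-ends-≡ _ (adj-sym v~p ∷ᵖ v~q ∷ᵖ []ᵖ)
                     ((≢-sym (adj⇒≢ v~p) ∷ p≢q ∷ []) ∷ (adj⇒≢ v~q ∷ []) ∷ [] ∷ [])
                     (≤-refl ∷ <⇒≤ p<v ∷ ≤-reflexive (sym q≡p) ∷ []) refl q≡p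
      where
      one-below : ∀ {w} → adj G v w ≡ true → dist G w x < dist G v x → dist G v x ≡ suc (dist G w x)
      one-below v~w w<v = ≤-antisym (dist-edge x v~w) w<v
      q≡p : dist G q x ≡ dist G p x
      q≡p = suc-injective (trans (sym (one-below v~q q<v)) (one-below v~p p<v))

    away-from-other-neighbour : ∀ {v w₁ w₂} → adj G v w₁ ≡ true → adj G v w₂ ≡ true → w₁ ≢ w₂ →
                                dist G w₂ x < dist G v x → dist G v x < dist G w₁ x
    away-from-other-neighbour {v} {w₁} v~w₁ v~w₂ w₁≢w₂ w₂<v with <-cmp (dist G v x) (dist G w₁ x)
    ... | tri< v<w₁ _ _ = v<w₁
    ... | tri≈ _ v≡w₁ _ = ⊥-elim (adjacent-dist-≢ v~w₁ v≡w₁)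
    ... | tri> _ _ w₁<v = ⊥-elim (w₁≢w₂ (lower-neighbour-unique v~w₁ v~w₂ w₁<v w₂<v))

  nG-across≤ : ∀ {v w₁ w₂} → adj G v w₁ ≡ true → adj G v w₂ ≡ true → w₁ ≢ w₂ → nG G w₂ v ≤ nG G v w₁
  nG-across≤ {v} {w₁} {w₂} v~w₁ v~w₂ w₁≢w₂ = count-mono λ y y-nearer-w₂ → <⇒<ᵇ≡true $
    subst₂ _<_ (dist-sym v y) (dist-sym w₁ y) $
    away-from-other-neighbour y v~w₁ v~w₂ w₁≢w₂ $
    subst₂ _<_ (dist-sym y w₂) (dist-sym y v) (<ᵇ≡true⇒< y-nearer-w₂)

  peripheral-neighbour-unique : ∀ {v w₁ w₂} → adj G v w₁ ≡ true → adj G v w₂ ≡ true →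
                                nG G v w₁ < nG G w₁ v → nG G v w₂ < nG G w₂ v → w₁ ≡ w₂
  peripheral-neighbour-unique {v} {w₁} {w₂} v~w₁ v~w₂ w₁-peri w₂-peri with w₁ ≟ w₂
  ... | yes w₁≡w₂ = w₁≡w₂
  ... | no w₁≢w₂ = ⊥-elim $ <-irrefl refl $ begin-strict
    nG G w₂ v  ≤⟨ nG-across≤ v~w₁ v~w₂ w₁≢w₂ ⟩
    nG G v w₁  <⟨ w₁-peri ⟩
    nG G w₁ v  ≤⟨ nG-across≤ v~w₂ v~w₁ (≢-sym w₁≢w₂) ⟩
    nG G v w₂  <⟨ w₂-peri ⟩
    nG G w₂ v  ∎
    where open ≤-Reasoning

  peri+deg≤n : ∀ v → peri G v + deg G v ≤ n
  peri+deg≤n v = begin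
    peri G v + deg G v                                ≡⟨ count-∨+∧ peripheral neighbour ⟩
    count peripheral-or-neighbour + count (λ u → peripheral u ∧ neighbour u)
                                                      ≤⟨ +-monoʳ-≤ _ (count≤1 at-most-one) ⟩
    count peripheral-or-neighbour + 1                 ≡⟨ +-comm _ 1 ⟩
    suc (count peripheral-or-neighbour)               ≤⟨ count<n v v-neither ⟩
    n                                                 ∎
    where
    open ≤-Reasoning
    peripheral neighbour peripheral-or-neighbour : Fin n → Bool
    peripheral u = nG G v u <ᵇ nG G u v
    neighbour = adj G v
    peripheral-or-neighbour u = peripheral u ∨ neighbour u

    v-neither : peripheral-or-neighbour v ≡ false
    v-neither = cong₂ _∨_ (n<ᵇn≡false (nG G v v)) (irrefl G v)

    at-most-one : ∀ i j → (peripheral i ∧ neighbour i) ≡ true → (peripheral j ∧ neighbour j) ≡ true →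
                  i ≡ j
    at-most-one i j i-both j-both with to T-∧ (≡true⇒T i-both) | to T-∧ (≡true⇒T j-both)
    ... | i-peri , v~i | j-peri , v~j =
      peripheral-neighbour-unique (T⇒≡true v~i) (T⇒≡true v~j) (<ᵇ⇒< _ _ i-peri) (<ᵇ⇒< _ _ j-peri)

-- The highest vertex of a cycle has two distinct lower neighbours on it.
acyclic-if-height : ∀ {n} (G : Graph n) (h : Fin n → ℕ) →
                    (∀ {a b} → adj G a b ≡ true → h a ≢ h b) →
                    (∀ {a b b′} → adj G a b ≡ true → adj G a b′ ≡ true → h b < h a → h b′ < h a → b ≡ b′) →
                    Acyclic G
acyclic-if-height G h adj⇒h≢ lower-unique k c c-injective c-closed =
  prev≢next top (c-injective (lower-unique top~prev top~next (lower top~prev) (lower top~next)))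
  where
  open Walks G using (adj-sym)
  top : Fin (3 + k)
  top = argmax (h ∘ c) zero (allFin _)
  top~next : adj G (c top) (c (next top)) ≡ true
  top~next = c-closed top
  top~prev : adj G (c top) (c (prev top)) ≡ true
  top~prev = adj-sym $
    subst (λ i → adj G (c (prev top)) (c i) ≡ true) (next-prev top) (c-closed (prev top))
  lower : ∀ {i} → adj G (c top) (c i) ≡ true → h (c i) < h (c top)
  lower {i} top~i = ≤∧≢⇒< (All.lookup (f[xs]≤f[argmax] {f = h ∘ c} zero (allFin _)) (∈-allFin i))
                          (≢-sym (adj⇒h≢ top~i))

-- Vertex i sits at height min(3, i) and edges join heights differing by one: the path
-- root – mid – hub with the m + 2 remaining vertices hanging off hub as leaves.
module Broom (m : ℕ) where

  N : ℕ
  N = 5 + m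

  pattern root = zero
  pattern mid = suc zero
  pattern hub = suc (suc zero)
  pattern leaf i = suc (suc (suc i))

  height : Fin N → ℕ
  height u = 3 ⊓ toℕ u

  one-above : Fin N → Fin N → Bool
  one-above u v = height u ≡ᵇ suc (height v)

  broom : Graph N
  broom = record
    { adj = λ u v → one-above u v ∨ one-above v u
    ; symm = λ u v → ∨-comm (one-above u v) (one-above v u)
    ; irrefl = λ v → cong₂ _∨_ (not-one-above-self v) (not-one-above-self v)
    }
    where
    not-one-above-self : ∀ v → one-above v v ≡ false
    not-one-above-self v = ¬-not (1+n≢n ∘ sym ∘ ≡ᵇ⇒≡ (height v) (suc (height v)) ∘ ≡true⇒T)

  open Walks broom

  adj⇒one-apart : ∀ {u v} → adj broom u v ≡ true → height u ≡ suc (height v) ⊎ height v ≡ suc (height u)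
  adj⇒one-apart {u} {v} u~v with to T-∨ (≡true⇒T u~v)
  ... | inj₁ u-above = inj₁ (≡ᵇ⇒≡ _ _ u-above)
  ... | inj₂ v-above = inj₂ (≡ᵇ⇒≡ _ _ v-above)

  height-step : ∀ {u v} → adj broom u v ≡ true → height u ≤ suc (height v)
  height-step u~v with adj⇒one-apart u~v
  ... | inj₁ u-above = ≤-reflexive u-above
  ... | inj₂ v-above rewrite v-above = ≤-trans (n≤1+n _) (n≤1+n _)

  height-injective-below-3 : ∀ {b b′} → height b ≡ height b′ → height b < 3 → b ≡ b′
  height-injective-below-3 {b} {b′} b≡b′ b<3 =
    toℕ-injective (trans (sym (height≡toℕ b<3)) (trans b≡b′ (height≡toℕ (subst (_< 3) b≡b′ b<3))))
    where
    height≡toℕ : ∀ {u} → height u < 3 → height u ≡ toℕ u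
    height≡toℕ {u} u<3 with ⊓-sel 3 (toℕ u)
    ... | inj₁ ≡3 = ⊥-elim (<-irrefl ≡3 u<3)
    ... | inj₂ ≡toℕ = ≡toℕ

  acyclic : Acyclic broom
  acyclic = acyclic-if-height broom height adj⇒height≢ lower-unique
    where
    adj⇒height≢ : ∀ {a b} → adj broom a b ≡ true → height a ≢ height b
    adj⇒height≢ {a} {b} a~b a≡b with adj⇒one-apart a~b
    ... | inj₁ a-above = 1+n≢n (sym (trans (sym a≡b) a-above))
    ... | inj₂ b-above = 1+n≢n (sym (trans a≡b b-above))

    below⇒one-below : ∀ {a b} → adj broom a b ≡ true → height b < height a → height a ≡ suc (height b)
    below⇒one-below a~b b<a with adj⇒one-apart a~b
    ... | inj₁ a-above = a-above
    ... | inj₂ b-above = ⊥-elim (<-asym b<a (≤-reflexive (sym b-above)))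

    lower-unique : ∀ {a b b′} → adj broom a b ≡ true → adj broom a b′ ≡ true →
                   height b < height a → height b′ < height a → b ≡ b′
    lower-unique {a} a~b a~b′ b<a b′<a = height-injective-below-3
      (suc-injective (trans (sym (below⇒one-below a~b b<a)) (below⇒one-below a~b′ b′<a)))
      (<-≤-trans b<a (m⊓n≤m 3 (toℕ a)))

  within-2-of-hub : ∀ u → Within 2 u hub
  within-2-of-hub root = within-∷ {w = mid} refl (within-∷ refl within-zero-refl)
  within-2-of-hub mid = within-suc (within-∷ refl within-zero-refl)
  within-2-of-hub hub = within-≤ z≤n within-zero-refl
  within-2-of-hub (leaf _) = within-suc (within-∷ refl within-zero-refl)

  connected : Connected broom
  connected u v = Within.holds $ within-≤ (m≤m+n 4 (suc m)) $
    within-++ (within-2-of-hub u) (within-sym (within-2-of-hub v))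

  is-tree : IsTree broom
  is-tree = connected , acyclic

  open Distance connected

  height≤dist-root : ∀ y → height y ≤ dist broom y root
  height≤dist-root y =
    subst (height y ≤_) (+-identityʳ _) (within-lipschitz height height-step (within-dist y root))

  far⇒nearer-than-root : ∀ {u y} → u ≢ root → 2 ≤ toℕ y → dist broom y u < dist broom y root
  far⇒nearer-than-root {u} {y} u≢root 2≤y = begin-strict
    dist broom y u     ≤⟨ dist≤ (short-walk u≢root 2≤y) ⟩
    pred (height y)    <⟨ pred-height<height 2≤y ⟩
    height y           ≤⟨ height≤dist-root y ⟩
    dist broom y root  ∎
    where
    open ≤-Reasoning
    short-walk : ∀ {u y} → u ≢ root → 2 ≤ toℕ y → Within (pred (height y)) y u
    short-walk {root} u≢root _ = ⊥-elim (u≢root refl)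
    short-walk {y = root} _ ()
    short-walk {y = mid} _ (s≤s ())
    short-walk {mid} {hub} _ _ = within-∷ refl within-zero-refl
    short-walk {hub} {hub} _ _ = within-suc within-zero-refl
    short-walk {leaf _} {hub} _ _ = within-∷ refl within-zero-refl
    short-walk {mid} {leaf _} _ _ = within-∷ {w = hub} refl (within-∷ refl within-zero-refl)
    short-walk {hub} {leaf _} _ _ = within-suc (within-∷ refl within-zero-refl)
    short-walk {leaf _} {leaf _} _ _ = within-∷ {w = hub} refl (within-∷ refl within-zero-refl)

    pred-height<height : ∀ {y} → 2 ≤ toℕ y → pred (height y) < height y
    pred-height<height {root} ()
    pred-height<height {mid} (s≤s ())
    pred-height<height {hub} _ = ≤-refl
    pred-height<height {leaf _} _ = ≤-refl

  root-peripheral-to : ∀ u → u ≢ root → nG broom root u < nG broom u root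
  root-peripheral-to u u≢root = begin-strict
    nG broom root u  ≤⟨ count≤-false-from {N} 2 (λ y → ¬-not ∘ not-nearer-root y) ⟩
    2                <⟨ s≤s (s≤s (s≤s z≤n)) ⟩
    N ∸ 2            ≤⟨ count≥-true-from {N} 2 (λ y → <⇒<ᵇ≡true ∘ far⇒nearer-than-root u≢root) ⟩
    nG broom u root  ∎
    where
    open ≤-Reasoning
    not-nearer-root : ∀ y → 2 ≤ toℕ y → (dist broom y root <ᵇ dist broom y u) ≢ true
    not-nearer-root y 2≤y = <-asym (far⇒nearer-than-root u≢root 2≤y) ∘ <ᵇ≡true⇒<

  N≤peri+deg : N ≤ peri broom root + deg broom root
  N≤peri+deg = subst (_≤ peri broom root + deg broom root) (+-comm (4 + m) 1) $
    +-mono-≤ (count≥-true-from {N} 1 λ u 1≤u → <⇒<ᵇ≡true (root-peripheral-to u λ { refl → n≮0 1≤u }))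
             (count-pos {p = adj broom root} mid refl)

mainTheorem16 : (n : ℕ) → 5 ≤ n →
    ((T : Graph n) → IsTree T → (v : Fin n) → peri T v + deg T v ≤ n)
    × Σ (Graph n) (λ T → IsTree T × Σ (Fin n) (λ v → peri T v + deg T v ≡ n))
mainTheorem16 n 5≤n with m , refl ← m≤n⇒∃[o]m+o≡n 5≤n =
  Tree.peri+deg≤n , broom , is-tree , root , ≤-antisym (Tree.peri+deg≤n broom is-tree root) N≤peri+deg
  where open Broom m
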